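{- Let $\sigma$ and $\tau$ be balanced words (of lengths $3m$ and $3n$ respectively, $m,n>0$). Then the concatenation $\sigma\tau$ (the word $\sigma$ followed by the word $\tau$) is balanced.
   Context: For an integer $n>0$, a word of length $3n$ is a sequence $s_1s_2\cdots s_{3n}$ of letters from $\{a,b,c\}$ in which each of $a,b,c$ occurs exactly $n$ times. For a word $\sigma=s_1\cdots s_{3n}$ define $q^+_\sigma(s_i)$ to be the number of $j<i$ with $s_j=b$ if $s_i=a$; the number of $j<i$ with $s_j=c$ if $s_i=b$; and the number of $j<i$ with $s_j=a$ if $s_i=c$. The word $\sigma$ is balanced if $\sum_{i: s_i=a} q^+_\sigma(s_i)=\sum_{i: s_i=b} q^+_\sigma(s_i)=\sum_{i: s_i=c} q^+_\sigma(s_i)$. (Equivalently, under the correspondence in which the set of dice $(A,B,C)$ partitioning $[3n]$ corresponds to the word whose $i$-th letter is $a$, $b$ or $c$ according as $i\in A$, $B$ or $C$, the word is balanced iff $P(A\succ B)=P(B\succ C)=P(C\succ A)$, where $P(X\succ Y)$ is the probability that an independent fair roll of $X$ exceeds one of $Y$.) -}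

module Defs where

open import Data.Nat using (ℕ; zero; suc; _+_; _*_; NonZero)
open import Data.List using (List; []; _∷_; length; _++_)
open import Relation.Binary.PropositionalEquality using (_≡_)
open import Data.Product using (_×_)

data Letter : Set where
  a b c : Letter

Word : Set
Word = List Letter

count : Letter → Word → ℕ
count x [] = 0
count a (a ∷ w) = suc (count a w)
count b (b ∷ w) = suc (count b w)
count c (c ∷ w) = suc (count c w)
count a (b ∷ w) = count a w
count a (c ∷ w) = count a w
count b (a ∷ w) = count b w
count b (c ∷ w) = count b w
count c (a ∷ w) = count c w
count c (b ∷ w) = count c w

-- the letter beaten by x: a counts preceding b's, b counts c's, c counts a's
target : Letter → Letter
target a = b
target b = c
target c = a

-- A word of length 3n: each of a, b, c occurs exactly n times
-- (so the length is automatically 3n).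
IsWordOfLength3 : ℕ → Word → Set
IsWordOfLength3 n w = (count a w ≡ n) × (count b w ≡ n) × (count c w ≡ n)

-- qSumAux x pre w = Σ over positions i in w with s_i = x of q⁺(s_i),
-- where pre is the (reversed) prefix preceding w.
qSumAux : Letter → Word → Word → ℕ
qSumAux x pre [] = 0
qSumAux a pre (a ∷ w) = count (target a) pre + qSumAux a (a ∷ pre) w
qSumAux b pre (b ∷ w) = count (target b) pre + qSumAux b (b ∷ pre) w
qSumAux c pre (c ∷ w) = count (target c) pre + qSumAux c (c ∷ pre) w
qSumAux a pre (y ∷ w) = qSumAux a (y ∷ pre) w
qSumAux b pre (y ∷ w) = qSumAux b (y ∷ pre) w
qSumAux c pre (y ∷ w) = qSumAux c (y ∷ pre) w

qSum : Letter → Word → ℕ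
qSum x w = qSumAux x [] w

Balanced : Word → Set
Balanced w = (qSum a w ≡ qSum b w) × (qSum b w ≡ qSum c w)

-- Splitting σ τ, the occurrences of x inside σ and inside τ keep their own
-- contributions to Σ q⁺, and each x in τ additionally sees every target x in σ:
--   qSum x (σ ++ τ) = qSum x σ + qSum x τ + count x τ · count (target x) σ.
-- For words of lengths 3m and 3n the cross term is n · m for every letter, so
-- balance of σ and of τ carries over to σ τ.
module Submission where

open import Defs
open import Data.Nat using (ℕ; NonZero; _+_; _*_)
open import Data.Nat.Properties using (+-assoc; +-comm; +-identityʳ; *-identityˡ)
open import Data.Nat.Tactic.RingSolver using (solve-∀)
open import Data.List using ([]; _∷_; _++_; _ʳ++_)
open import Data.Product using (_,_)
open import Relation.Binary.PropositionalEquality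
  using (_≡_; refl; sym; trans; cong; cong₂; module ≡-Reasoning)

δ : Letter → Letter → ℕ
δ a a = 1
δ b b = 1
δ c c = 1
δ _ _ = 0

count-∷ : ∀ x y w → count x (y ∷ w) ≡ δ x y + count x w
count-∷ a a w = refl
count-∷ b b w = refl
count-∷ c c w = refl
count-∷ a b w = refl
count-∷ a c w = refl
count-∷ b a w = refl
count-∷ b c w = refl
count-∷ c a w = refl
count-∷ c b w = refl

qSumAux-∷ : ∀ x y pre w →
  qSumAux x pre (y ∷ w) ≡ δ x y * count (target x) pre + qSumAux x (y ∷ pre) w
qSumAux-∷ a a pre w = cong (_+ qSumAux a (a ∷ pre) w) (sym (*-identityˡ (count b pre)))
qSumAux-∷ b b pre w = cong (_+ qSumAux b (b ∷ pre) w) (sym (*-identityˡ (count c pre)))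
qSumAux-∷ c c pre w = cong (_+ qSumAux c (c ∷ pre) w) (sym (*-identityˡ (count a pre)))
qSumAux-∷ a b pre w = refl
qSumAux-∷ a c pre w = refl
qSumAux-∷ b a pre w = refl
qSumAux-∷ b c pre w = refl
qSumAux-∷ c a pre w = refl
qSumAux-∷ c b pre w = refl

count-++ : ∀ x u v → count x (u ++ v) ≡ count x u + count x v
count-++ x [] v = refl
count-++ x (y ∷ u) v = begin
  count x (y ∷ u ++ v)               ≡⟨ count-∷ x y (u ++ v) ⟩
  δ x y + count x (u ++ v)           ≡⟨ cong (δ x y +_) (count-++ x u v) ⟩
  δ x y + (count x u + count x v)    ≡⟨ +-assoc (δ x y) _ _ ⟨
  (δ x y + count x u) + count x v    ≡⟨ cong (_+ count x v) (sym (count-∷ x y u)) ⟩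
  count x (y ∷ u) + count x v        ∎
  where open ≡-Reasoning

count-ʳ++ : ∀ x u v → count x (u ʳ++ v) ≡ count x u + count x v
count-ʳ++ x [] v = refl
count-ʳ++ x (y ∷ u) v = begin
  count x (u ʳ++ y ∷ v)              ≡⟨ count-ʳ++ x u (y ∷ v) ⟩
  count x u + count x (y ∷ v)        ≡⟨ cong (count x u +_) (count-∷ x y v) ⟩
  count x u + (δ x y + count x v)    ≡⟨ +-assoc (count x u) _ _ ⟨
  (count x u + δ x y) + count x v    ≡⟨ cong (_+ count x v) (+-comm (count x u) _) ⟩
  (δ x y + count x u) + count x v    ≡⟨ cong (_+ count x v) (sym (count-∷ x y u)) ⟩
  count x (y ∷ u) + count x v        ∎
  where open ≡-Reasoning

-- The accumulator of qSumAux is the reversed prefix, hence the ʳ++.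
qSumAux-++ : ∀ x pre u v →
  qSumAux x pre (u ++ v) ≡ qSumAux x pre u + qSumAux x (u ʳ++ pre) v
qSumAux-++ x pre [] v = refl
qSumAux-++ x pre (y ∷ u) v = begin
  qSumAux x pre (y ∷ u ++ v)
    ≡⟨ qSumAux-∷ x y pre (u ++ v) ⟩
  k + qSumAux x (y ∷ pre) (u ++ v)
    ≡⟨ cong (k +_) (qSumAux-++ x (y ∷ pre) u v) ⟩
  k + (qSumAux x (y ∷ pre) u + qSumAux x (u ʳ++ y ∷ pre) v)
    ≡⟨ +-assoc k _ _ ⟨
  (k + qSumAux x (y ∷ pre) u) + qSumAux x (u ʳ++ y ∷ pre) v
    ≡⟨ cong (_+ qSumAux x (u ʳ++ y ∷ pre) v) (sym (qSumAux-∷ x y pre u)) ⟩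
  qSumAux x pre (y ∷ u) + qSumAux x ((y ∷ u) ʳ++ pre) v ∎
  where
  open ≡-Reasoning
  k = δ x y * count (target x) pre

qSumAux-prefix-++ : ∀ x p pre w →
  qSumAux x (p ++ pre) w ≡ qSumAux x p w + count x w * count (target x) pre
qSumAux-prefix-++ x p pre [] = refl
qSumAux-prefix-++ x p pre (y ∷ w) = begin
  qSumAux x (p ++ pre) (y ∷ w)
    ≡⟨ qSumAux-∷ x y (p ++ pre) w ⟩
  d * count t (p ++ pre) + qSumAux x (y ∷ p ++ pre) w
    ≡⟨ cong₂ (λ k q → d * k + q) (count-++ t p pre) (qSumAux-prefix-++ x (y ∷ p) pre w) ⟩
  d * (count t p + count t pre) + (qSumAux x (y ∷ p) w + count x w * count t pre)
    ≡⟨ regroup d (count t p) (count t pre) _ (count x w) ⟩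
  (d * count t p + qSumAux x (y ∷ p) w) + (d + count x w) * count t pre
    ≡⟨ cong₂ (λ q k → q + k * count t pre) (sym (qSumAux-∷ x y p w)) (sym (count-∷ x y w)) ⟩
  qSumAux x p (y ∷ w) + count x (y ∷ w) * count t pre ∎
  where
  open ≡-Reasoning
  d = δ x y
  t = target x
  regroup : ∀ d p q r k → d * (p + q) + (r + k * q) ≡ (d * p + r) + (d + k) * q
  regroup = solve-∀

qSum-++ : ∀ x u v →
  qSum x (u ++ v) ≡ qSum x u + qSum x v + count x v * count (target x) u
qSum-++ x u v = begin
  qSum x (u ++ v)
    ≡⟨ qSumAux-++ x [] u v ⟩
  qSum x u + qSumAux x (u ʳ++ []) v
    ≡⟨ cong (qSum x u +_) (qSumAux-prefix-++ x [] (u ʳ++ []) v) ⟩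
  qSum x u + (qSum x v + count x v * count (target x) (u ʳ++ []))
    ≡⟨ cong (λ k → qSum x u + (qSum x v + count x v * k))
            (trans (count-ʳ++ (target x) u []) (+-identityʳ _)) ⟩
  qSum x u + (qSum x v + count x v * count (target x) u)
    ≡⟨ +-assoc (qSum x u) _ _ ⟨
  qSum x u + qSum x v + count x v * count (target x) u ∎
  where open ≡-Reasoning

count-of-word : ∀ {n} w → IsWordOfLength3 n w → ∀ x → count x w ≡ n
count-of-word _ (wa , wb , wc) a = wa
count-of-word _ (wa , wb , wc) b = wb
count-of-word _ (wa , wb , wc) c = wc

qSum-++-words : ∀ {m n} σ τ → IsWordOfLength3 m σ → IsWordOfLength3 n τ →
  ∀ x → qSum x (σ ++ τ) ≡ qSum x σ + qSum x τ + n * m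
qSum-++-words {m} {n} σ τ σ-word τ-word x = begin
  qSum x (σ ++ τ)
    ≡⟨ qSum-++ x σ τ ⟩
  qSum x σ + qSum x τ + count x τ * count (target x) σ
    ≡⟨ cong₂ (λ k l → qSum x σ + qSum x τ + k * l)
             (count-of-word τ τ-word x) (count-of-word σ σ-word (target x)) ⟩
  qSum x σ + qSum x τ + n * m ∎
  where open ≡-Reasoning

lemma2p4 : (m n : ℕ) → .{{NonZero m}} → .{{NonZero n}} →
    (σ τ : Word) → IsWordOfLength3 m σ → IsWordOfLength3 n τ →
    Balanced σ → Balanced τ → Balanced (σ ++ τ)
lemma2p4 m n σ τ σ-word τ-word (σab , σbc) (τab , τbc) =
  transfer a b σab τab , transfer b c σbc τbc
  where
  open ≡-Reasoning
  transfer : ∀ x y → qSum x σ ≡ qSum y σ → qSum x τ ≡ qSum y τ →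
    qSum x (σ ++ τ) ≡ qSum y (σ ++ τ)
  transfer x y σxy τxy = begin
    qSum x (σ ++ τ)             ≡⟨ qSum-++-words σ τ σ-word τ-word x ⟩
    qSum x σ + qSum x τ + n * m ≡⟨ cong₂ (λ s t → s + t + n * m) σxy τxy ⟩
    qSum y σ + qSum y τ + n * m ≡⟨ sym (qSum-++-words σ τ σ-word τ-word y) ⟩
    qSum y (σ ++ τ)             ∎
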